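{- Let $G=(V,E)$ be an $s$-$t$ graph and $C\subseteq V$ a set of vertices. A sequence $X$ of vertices is safe for $C$-walk covers if and only if there exists a vertex $v\in C$ such that $X$ is a subsequence of $\mathrm{ext}(v)$.
   Context: An $s$-$t$ graph is a directed graph without parallel edges (self-loops allowed) with a unique source $s$ and a unique sink $t$. A walk is a sequence of vertices with consecutive vertices joined by edges (vertices/edges may repeat). A $C$-walk cover is a set $P$ of $s$-$t$ walks such that every vertex of $C$ lies on some walk of $P$. A sequence $X=u_1,\dots,u_\ell$ of vertices requires a $u_i$-$u_{i+1}$ path for each $i$; $X$ is a subsequence of $X'$ if obtained by deleting entries of $X'$. $X$ is safe for $C$-walk covers ($C$-safe) if for every $C$-walk cover $P$ some $W\in P$ has $X$ as a subsequence. $u$ $s$-dominates $v$ if every $s$-$v$ path contains $u$; $u$ $t$-dominates $v$ if every $v$-$t$ path contains $u$. The $s$-dominator tree is rooted at $s$, each $v\ne s$ having its immediate $s$-dominator as parent; the $t$-dominator tree is analogous, rooted at $t$. $\mathrm{ext}(v)$ is the path from $s$ to $v$ in the $s$-dominator tree concatenated with the path from $v$ to $t$ in the $t$-dominator tree ($v$ written once). -}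

module Defs where

open import Level using (0ℓ)
open import Data.Nat using (ℕ)
open import Data.Fin using (Fin)
open import Data.List using (List; []; _∷_; _++_; reverse; drop)
open import Data.List.Membership.Propositional using () renaming (_∈_ to _∈ₗ_)
open import Data.List.Relation.Unary.Unique.Propositional using (Unique)
open import Data.List.Relation.Binary.Sublist.Propositional using (_⊆_)
open import Data.Fin.Subset using (Subset) renaming (_∈_ to _∈ₛ_)
open import Data.Product using (Σ; ∃; _×_; _,_)
open import Relation.Binary.Definitions using (Decidable)
open import Relation.Binary.PropositionalEquality using (_≡_)
open import Relation.Nullary using (¬_)

data WalkFromTo {n : ℕ} (E : Fin n → Fin n → Set) : Fin n → Fin n → List (Fin n) → Set where
  here : ∀ {a} → WalkFromTo E a a (a ∷ [])
  step : ∀ {a b c xs} → E a b → WalkFromTo E b c xs → WalkFromTo E a c (a ∷ xs)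

PathFromTo : {n : ℕ} → (Fin n → Fin n → Set) → Fin n → Fin n → List (Fin n) → Set
PathFromTo E a b xs = WalkFromTo E a b xs × Unique xs

-- An s-t graph on vertex set Fin n: directed graph given by an edge relation
-- (so no parallel edges; self-loops allowed), with a unique source s and unique
-- sink t, and (standing convention) every vertex on some s-t path.
record STGraph (n : ℕ) : Set₁ where
  field
    E      : Fin n → Fin n → Set
    E?     : Decidable E
    s      : Fin n
    t      : Fin n
    s-source  : ∀ u → ¬ E u s
    t-sink    : ∀ u → ¬ E t u
    source-unique : ∀ v → (∀ u → ¬ E u v) → v ≡ s
    sink-unique   : ∀ v → (∀ u → ¬ E v u) → v ≡ t
    reach-from-s  : ∀ v → ∃ λ p → PathFromTo E s v p
    reach-to-t    : ∀ v → ∃ λ p → PathFromTo E v t p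

module _ {n : ℕ} (G : STGraph n) where
  open STGraph G

  SDom : Fin n → Fin n → Set
  SDom u v = ∀ p → PathFromTo E s v p → u ∈ₗ p

  TDom : Fin n → Fin n → Set
  TDom u v = ∀ p → PathFromTo E v t p → u ∈ₗ p

  IsIdom : (Fin n → Fin n → Set) → Fin n → Fin n → Fin n → Set
  IsIdom Dom root u v =
    ¬ (v ≡ root) × ¬ (u ≡ v) × Dom u v × (∀ w → ¬ (w ≡ v) → Dom w v → Dom w u)

  -- UpChain Dom root v xs : xs = v, idom(v), idom(idom(v)), ..., root,
  -- i.e. the path from v up to the root in the dominator tree.
  data UpChain (Dom : Fin n → Fin n → Set) (root : Fin n) : Fin n → List (Fin n) → Set where
    at-root : UpChain Dom root root (root ∷ [])
    up      : ∀ {u v xs} → IsIdom Dom root u v → UpChain Dom root u xs →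
              UpChain Dom root v (v ∷ xs)

  -- ExtIs v L : L = ext(v) = (s-dom-tree path s..v) ++ (t-dom-tree path v..t), v once.
  ExtIs : Fin n → List (Fin n) → Set
  ExtIs v L = Σ (List (Fin n)) λ ls → Σ (List (Fin n)) λ lt →
    UpChain SDom s v ls × UpChain TDom t v lt × (L ≡ reverse ls ++ drop 1 lt)

  STWalk : List (Fin n) → Set
  STWalk = WalkFromTo E s t

  WalkCover : Subset n → (List (Fin n) → Set) → Set
  WalkCover C P = (∀ W → P W → STWalk W) × (∀ v → v ∈ₛ C → ∃ λ W → P W × v ∈ₗ W)

  Safe : Subset n → List (Fin n) → Set₁
  Safe C X = (P : List (Fin n) → Set) → WalkCover C P → ∃ λ W → P W × X ⊆ W

  data Linked : List (Fin n) → Set where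
    []  : Linked []
    [_] : ∀ u → Linked (u ∷ [])
    _∷_ : ∀ {u v xs} → (∃ λ p → PathFromTo E u v p) → Linked (v ∷ xs) → Linked (u ∷ v ∷ xs)

-- ext(v) is a subsequence of every s-t walk through v: the s-dominators of v occur, in
-- dominator-tree order, on every s-v walk, and the t-dominators on every v-t walk. So every
-- C-walk cover has a walk containing ext(v) for each v ∈ C, which gives sufficiency.
-- Conversely, if X is a subsequence of no ext(v) with v ∈ C, fix such a v and let Y be the
-- longest prefix of X lying on every s-v path; Y is then a subsequence of the s-part of ext(v),
-- since its vertices s-dominate v and all appear in order on one path. The rest x ∷ Z of X
-- cannot lie after v on every v-t path (it would be in the t-part of ext(v)), so some v-t path
-- q misses it, while by maximality some s-v path p misses Y followed by x. Then p followed by q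
-- is an s-t walk through v not containing X, and these walks form a cover refuting safety.
-- A graph on Fin n has finitely many paths, so all these case distinctions are decidable.
module Submission where

open import Defs
open import Data.Nat using (ℕ; zero; suc; _≤_; z≤n; s≤s)
open import Data.Fin using (Fin; _≟_)
open import Data.Fin.Properties using () renaming (any? to anyFin?)
open import Data.Fin.Subset using (Subset; _∈_)
open import Data.Fin.Subset.Properties using (_∈?_)
open import Data.List using (List; []; _∷_; _++_; reverse; drop; length; map; concatMap; allFin)
open import Data.List.Properties
  using (∷-injectiveˡ; ++-assoc; unfold-reverse; reverse-involutive; length-tabulate)
open import Data.List.Membership.Propositional using (lose) renaming (_∈_ to _∈ₗ_)
open import Data.List.Membership.Propositional.Properties
  using (∈-++⁺ˡ; ∈-++⁺ʳ; ∈-++⁻; ∈-∃++; ∈-map⁺; ∈-concatMap⁺; ∈-allFin)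
open import Data.List.Relation.Unary.Any using (here; there; any?; satisfied)
open import Data.List.Relation.Unary.Any.Properties using (reverse⁻)
open import Data.List.Relation.Unary.All using (All; []; _∷_)
import Data.List.Relation.Unary.All as All
open import Data.List.Relation.Unary.All.Properties using (¬Any⇒All¬)
open import Data.List.Relation.Unary.AllPairs using ([]; _∷_)
open import Data.List.Relation.Unary.Unique.Propositional using (Unique)
open import Data.List.Relation.Binary.Sublist.Propositional
  using (_⊆_; []; _∷_; _∷ʳ_; ⊆-refl; ⊆-trans; lookup)
open import Data.List.Relation.Binary.Sublist.Propositional.Properties
  using ([]⊆-universal; ++⁺; ++⁺ˡ; drop⁺-⊆; reverse⁺)
import Data.List.Relation.Binary.Permutation.Setoid as Perm
import Data.List.Relation.Binary.Permutation.Setoid.Properties as PermProp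
open import Data.Product using (∃; ∃₂; _×_; _,_; proj₁; proj₂; uncurry)
import Data.Product as Product
open import Data.Sum using (_⊎_; inj₁; inj₂; [_,_]′)
import Data.Sum as Sum
open import Function using (_∘_; flip)
open import Function.Bundles using (_⇔_; mk⇔)
open Function.Bundles.Equivalence using (to; from)
open import Function.Properties.Equivalence using () renaming (sym to ⇔-sym)
open import Relation.Nullary using (¬_; Dec; yes; no; ¬?; contradiction)
open import Relation.Nullary.Decidable using (_×-dec_; map′; decidable-stable)
open import Relation.Binary.Definitions using (Decidable)
open import Relation.Binary.PropositionalEquality
  using (_≡_; _≢_; refl; sym; cong; subst; setoid)
import Relation.Unary as U

module _ {A : Set} where

  ∈-++∷⁻ : ∀ (as : List A) {x bs z} → z ∈ₗ as ++ x ∷ bs → z ≢ x → z ∈ₗ as ++ bs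
  ∈-++∷⁻ as z∈ z≢x with ∈-++⁻ as z∈
  ... | inj₁ z∈as = ∈-++⁺ˡ z∈as
  ... | inj₂ (here z≡x) = contradiction z≡x z≢x
  ... | inj₂ (there z∈bs) = ∈-++⁺ʳ as z∈bs

  length-++∷ : ∀ as {x : A} {bs} → length (as ++ x ∷ bs) ≡ suc (length (as ++ bs))
  length-++∷ [] = refl
  length-++∷ (a ∷ as) = cong suc (length-++∷ as)

  length-unique-≤ : {xs ys : List A} → Unique xs → (∀ {z} → z ∈ₗ xs → z ∈ₗ ys) →
                    length xs ≤ length ys
  length-unique-≤ {[]} _ _ = z≤n
  length-unique-≤ {x ∷ xs} (x∉xs ∷ xs!) xs⊆ys with ∈-∃++ (xs⊆ys (here refl))
  ... | as , bs , refl = subst (suc (length xs) ≤_) (sym (length-++∷ as)) (s≤s (length-unique-≤ xs!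
          λ z∈xs → ∈-++∷⁻ as (xs⊆ys (there z∈xs)) (All.lookup x∉xs z∈xs ∘ sym)))

  unique-++⁻ʳ : ∀ as {bs : List A} → Unique (as ++ bs) → Unique bs
  unique-++⁻ʳ [] bs! = bs!
  unique-++⁻ʳ (a ∷ as) (_ ∷ u) = unique-++⁻ʳ as u

  unique-reverse : {xs : List A} → Unique xs → Unique (reverse xs)
  unique-reverse {xs} = PermProp.Unique-resp-↭ (setoid A)
                          (Perm.↭-sym (setoid A) (PermProp.↭-reverse (setoid A) xs))

  ⊆-reverseʳ : {xs ys : List A} → xs ⊆ reverse ys → reverse xs ⊆ ys
  ⊆-reverseʳ {xs} {ys} σ = subst (reverse xs ⊆_) (reverse-involutive ys) (reverse⁺ σ)

  ⊆-reverseˡ : {xs ys : List A} → reverse xs ⊆ ys → xs ⊆ reverse ys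
  ⊆-reverseˡ {xs} {ys} σ = subst (_⊆ reverse ys) (reverse-involutive xs) (reverse⁺ σ)

  ++∷⊆++⁻ : ∀ ys {x zs} ps {qs : List A} →
            ys ++ x ∷ zs ⊆ ps ++ qs → ys ++ x ∷ [] ⊆ ps ⊎ x ∷ zs ⊆ qs
  ++∷⊆++⁻ ys [] σ = inj₂ (⊆-trans (++⁺ˡ ys ⊆-refl) σ)
  ++∷⊆++⁻ [] (p ∷ ps) (.p ∷ʳ σ) = Sum.map₁ (p ∷ʳ_) (++∷⊆++⁻ [] ps σ)
  ++∷⊆++⁻ [] (p ∷ ps) (refl ∷ σ) = inj₁ (refl ∷ []⊆-universal ps)
  ++∷⊆++⁻ (y ∷ ys) (p ∷ ps) (.p ∷ʳ σ) = Sum.map₁ (p ∷ʳ_) (++∷⊆++⁻ (y ∷ ys) ps σ)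
  ++∷⊆++⁻ (y ∷ ys) (p ∷ ps) (refl ∷ σ) = Sum.map₁ (refl ∷_) (++∷⊆++⁻ ys ps σ)

  ∈-∷⁻ : ∀ {z : A} {zs xs ys} → All (z ≢_) zs → ys ⊆ zs →
         (∀ {y} → y ∈ₗ ys → y ∈ₗ z ∷ xs) → ∀ {y} → y ∈ₗ ys → y ∈ₗ xs
  ∈-∷⁻ z∉zs τ ys⊆z∷xs y∈ys with ys⊆z∷xs y∈ys
  ... | here y≡z = contradiction (sym y≡z) (All.lookup z∉zs (lookup τ y∈ys))
  ... | there y∈xs = y∈xs

  unique-⊆-by-∈ : {xs ys zs : List A} → Unique zs → xs ⊆ zs → ys ⊆ zs →
                  (∀ {y} → y ∈ₗ ys → y ∈ₗ xs) → ys ⊆ xs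
  unique-⊆-by-∈ [] [] [] _ = []
  unique-⊆-by-∈ (_ ∷ zs!) (z ∷ʳ σ) (.z ∷ʳ τ) ys⊆xs = unique-⊆-by-∈ zs! σ τ ys⊆xs
  unique-⊆-by-∈ (z∉zs ∷ zs!) (refl ∷ σ) (z ∷ʳ τ) ys⊆xs =
    z ∷ʳ unique-⊆-by-∈ zs! σ τ (∈-∷⁻ z∉zs τ ys⊆xs)
  unique-⊆-by-∈ (z∉zs ∷ _) (z ∷ʳ σ) (refl ∷ τ) ys⊆xs =
    contradiction refl (All.lookup z∉zs (lookup σ (ys⊆xs (here refl))))
  unique-⊆-by-∈ (z∉zs ∷ zs!) (refl ∷ σ) (refl ∷ τ) ys⊆xs =
    refl ∷ unique-⊆-by-∈ zs! σ τ (∈-∷⁻ z∉zs τ (ys⊆xs ∘ there))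

module _ {A : Set} {P P̸ Q Q̸ : List A → Set}
         (P? : ∀ xs → P xs ⊎ P̸ xs) (Q? : ∀ xs → Q xs ⊎ Q̸ xs) (Q[] : Q []) where

  Splits : List A → Set
  Splits xs = ∃₂ λ ys zs → xs ≡ ys ++ zs × P ys × Q zs

  Cuts : List A → Set
  Cuts xs = ∃₂ λ ys x → ∃ λ zs → xs ≡ ys ++ x ∷ zs × P̸ (ys ++ x ∷ []) × Q̸ (x ∷ zs)

  splits-or-cuts : ∀ ys zs → P ys → Splits (ys ++ zs) ⊎ Cuts (ys ++ zs)
  splits-or-cuts ys [] Pys = inj₁ (ys , [] , refl , Pys , Q[])
  splits-or-cuts ys (x ∷ zs) Pys with Q? (x ∷ zs) | P? (ys ++ x ∷ [])
  ... | inj₁ Qxzs | _ = inj₁ (ys , x ∷ zs , refl , Pys , Qxzs)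
  ... | inj₂ Q̸xzs | inj₂ P̸ysx = inj₂ (ys , x , zs , refl , P̸ysx , Q̸xzs)
  ... | inj₂ _ | inj₁ Pysx = subst (λ xs → Splits xs ⊎ Cuts xs) (++-assoc ys (x ∷ []) zs)
                                   (splits-or-cuts (ys ++ x ∷ []) zs Pysx)

module _ {n : ℕ} {E : Fin n → Fin n → Set} where

  open import Data.List.Membership.DecPropositional (_≟_ {n}) using () renaming (_∈?_ to _∈ₗ?_)

  walk-head : ∀ {a b xs} → WalkFromTo E a b xs → xs ≡ a ∷ drop 1 xs
  walk-head here = refl
  walk-head (step _ _) = refl

  walk-end∈ : ∀ {a b xs} → WalkFromTo E a b xs → b ∈ₗ xs
  walk-end∈ here = here refl
  walk-end∈ (step _ w) = there (walk-end∈ w)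

  walk-++ : ∀ {a b c xs ys} → WalkFromTo E a b xs → WalkFromTo E b c ys →
            WalkFromTo E a c (xs ++ drop 1 ys)
  walk-++ here here = here
  walk-++ here (step e w) = step e w
  walk-++ (step e w₁) w₂ = step e (walk-++ w₁ w₂)

  walk-split : ∀ as {a c x bs} → WalkFromTo E a c (as ++ x ∷ bs) →
               WalkFromTo E a x (as ++ x ∷ []) × WalkFromTo E x c (x ∷ bs)
  walk-split [] w with ∷-injectiveˡ (walk-head w)
  ... | refl = here , w
  walk-split (_ ∷ []) (step e w) = Product.map₁ (step e) (walk-split [] w)
  walk-split (_ ∷ a ∷ as) (step e w) = Product.map₁ (step e) (walk-split (a ∷ as) w)

  walk⇒path : ∀ {a b xs} → WalkFromTo E a b xs →
              ∃ λ p → PathFromTo E a b p × (∀ {z} → z ∈ₗ p → z ∈ₗ xs)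
  walk⇒path here = _ , (here , [] ∷ []) , λ z∈p → z∈p
  walk⇒path {a} (step e w) with walk⇒path w
  ... | p , (wp , p!) , p⊆w with a ∈ₗ? p
  ...   | no a∉p = a ∷ p , (step e wp , ¬Any⇒All¬ p a∉p ∷ p!) ,
                   λ { (here refl) → here refl ; (there z∈p) → there (p⊆w z∈p) }
  ...   | yes a∈p with ∈-∃++ a∈p
  ...     | as , bs , refl = a ∷ bs , (proj₂ (walk-split as wp) , unique-++⁻ʳ as p!) ,
                             there ∘ p⊆w ∘ ∈-++⁺ʳ as

  ∈-all-paths⇒∈-walk : ∀ {a b u xs} → (∀ p → PathFromTo E a b p → u ∈ₗ p) →
                       WalkFromTo E a b xs → u ∈ₗ xs
  ∈-all-paths⇒∈-walk u∈paths w with walk⇒path w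
  ... | p , pp , p⊆w = p⊆w (u∈paths p pp)

walk-reverse : ∀ {n} {E : Fin n → Fin n → Set} {a b xs} →
               WalkFromTo E a b xs → WalkFromTo (flip E) b a (reverse xs)
walk-reverse here = here
walk-reverse {a = a} (step {xs = xs} e w) =
  subst (WalkFromTo _ _ a) (sym (unfold-reverse a xs)) (walk-++ (walk-reverse w) (step e here))

path-reverse : ∀ {n} {E : Fin n → Fin n → Set} {a b xs} →
               PathFromTo E a b xs → PathFromTo (flip E) b a (reverse xs)
path-reverse (w , xs!) = walk-reverse w , unique-reverse xs!

module _ {n : ℕ} where

  lists≤ : ℕ → List (List (Fin n))
  lists≤ zero = [] ∷ []
  lists≤ (suc k) = [] ∷ concatMap (λ x → map (x ∷_) (lists≤ k)) (allFin n)

  ∈-lists≤ : ∀ {k} xs → length xs ≤ k → xs ∈ₗ lists≤ k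
  ∈-lists≤ {zero} [] _ = here refl
  ∈-lists≤ {suc k} [] _ = here refl
  ∈-lists≤ {suc k} (x ∷ xs) (s≤s |xs|≤k) =
    there (∈-concatMap⁺ _ (lose (∈-allFin x) (∈-map⁺ (x ∷_) (∈-lists≤ xs |xs|≤k))))

  length-unique-Fin : {xs : List (Fin n)} → Unique xs → length xs ≤ n
  length-unique-Fin {xs} xs! =
    subst (length xs ≤_) (length-tabulate λ i → i) (length-unique-≤ xs! λ {z} _ → ∈-allFin z)

module _ {n : ℕ} {E : Fin n → Fin n → Set} (E? : Decidable E) where

  open import Data.List.Relation.Unary.Unique.DecPropositional (_≟_ {n}) using (unique?)

  walk∷? : ∀ a b xs → Dec (WalkFromTo E a b (a ∷ xs))
  walk∷? a b [] = map′ (λ { refl → here }) (λ { here → refl }) (a ≟ b)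
  walk∷? a b (x ∷ xs) = map′ (uncurry step) step⁻ (E? a x ×-dec walk∷? x b xs)
    where
    step⁻ : WalkFromTo E a b (a ∷ x ∷ xs) → E a x × WalkFromTo E x b (x ∷ xs)
    step⁻ (step e w) with ∷-injectiveˡ (walk-head w)
    ... | refl = e , w

  walk? : ∀ a b xs → Dec (WalkFromTo E a b xs)
  walk? a b [] = no λ ()
  walk? a b (x ∷ xs) with a ≟ x
  ... | yes refl = walk∷? a b xs
  ... | no a≢x = no λ w → a≢x (sym (∷-injectiveˡ (walk-head w)))

  path? : ∀ a b p → Dec (PathFromTo E a b p)
  path? a b p = walk? a b p ×-dec unique? p

  all-paths-or-counterexample : {Q : List (Fin n) → Set} → U.Decidable Q → ∀ a b →
    (∀ p → PathFromTo E a b p → Q p) ⊎ (∃ λ p → PathFromTo E a b p × ¬ Q p)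
  all-paths-or-counterexample Q? a b with any? (λ p → path? a b p ×-dec ¬? (Q? p)) (lists≤ n)
  ... | yes counterexample = inj₂ (satisfied counterexample)
  ... | no none = inj₁ λ p pp → decidable-stable (Q? p) λ ¬Qp →
        none (lose (∈-lists≤ p (length-unique-Fin (proj₂ pp))) (pp , ¬Qp))

PostDom : ∀ {n} → (Fin n → Fin n → Set) → Fin n → Fin n → Fin n → Set
PostDom E r u v = ∀ p → PathFromTo E v r p → u ∈ₗ p

module _ {n : ℕ} (G : STGraph n) where

  UpChain-resp-⇔ : ∀ {D₁ D₂ : Fin n → Fin n → Set} {r v ls} → (∀ {u v} → D₁ u v ⇔ D₂ u v) →
                   UpChain G D₁ r v ls → UpChain G D₂ r v ls
  UpChain-resp-⇔ D₁⇔D₂ at-root = at-root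
  UpChain-resp-⇔ D₁⇔D₂ (up (v≢r , u≢v , u⊒v , u-greatest) ch) =
    up (v≢r , u≢v , to D₁⇔D₂ u⊒v , λ w w≢v → to D₁⇔D₂ ∘ u-greatest w w≢v ∘ from D₁⇔D₂)
       (UpChain-resp-⇔ D₁⇔D₂ ch)

-- UpChain depends on its graph argument only through the vertex set, so it also describes
-- postdominator chains of an arbitrary relation E on the same vertices.
module PostDominatorChains {n : ℕ} (G : STGraph n) {E : Fin n → Fin n → Set} (E? : Decidable E)
                           (r : Fin n) where

  open import Data.List.Membership.DecPropositional (_≟_ {n}) using () renaming (_∈?_ to _∈ₗ?_)

  Chain : Fin n → List (Fin n) → Set
  Chain = UpChain G (PostDom E r) r

  root-postdom : ∀ v → PostDom E r r v
  root-postdom v p (w , _) = walk-end∈ w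

  postdom-step : ∀ {x y z} → E x y → PostDom E r z x → z ≢ x → PostDom E r z y
  postdom-step e z⊒x z≢x q (w , _) with ∈-all-paths⇒∈-walk z⊒x (step e w)
  ... | here z≡x = contradiction z≡x z≢x
  ... | there z∈q = z∈q

  postdom? : ∀ u v → Dec (PostDom E r u v)
  postdom? u v with all-paths-or-counterexample E? (u ∈ₗ?_) v r
  ... | inj₁ u∈paths = yes u∈paths
  ... | inj₂ (p , pp , u∉p) = no λ u⊒v → u∉p (u⊒v p pp)

  -- The first strict postdominator of v met along a walk from v is the immediate one: climb keeps
  -- the invariant that every strict postdominator of v postdominates the current vertex x.
  mutual
    chain-via : ∀ {v y xs} → E v y → WalkFromTo E y r xs → ∃ (Chain v)
    chain-via {v} e w with v ≟ r
    ... | yes refl = _ , at-root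
    ... | no v≢r = climb v≢r (λ z z≢v z⊒v → postdom-step e z⊒v z≢v) w

    climb : ∀ {v x xs} → v ≢ r → (∀ z → z ≢ v → PostDom E r z v → PostDom E r z x) →
            WalkFromTo E x r xs → ∃ (Chain v)
    climb v≢r below here = _ , up (v≢r , v≢r ∘ sym , root-postdom _ , below) at-root
    climb {v} {x} v≢r below (step e w) with ¬? (x ≟ v) ×-dec postdom? x v
    ... | yes (x≢v , x⊒v) = _ , up (v≢r , x≢v , x⊒v , below) (proj₂ (chain-via e w))
    ... | no x-not-strict = climb v≢r (λ z z≢v z⊒v → postdom-step e (below z z≢v z⊒v)
                                         λ { refl → x-not-strict (z≢v , z⊒v) }) w

  chain-from-walk : ∀ {v xs} → WalkFromTo E v r xs → ∃ (Chain v)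
  chain-from-walk here = _ , at-root
  chain-from-walk (step e w) = chain-via e w

  chain⊆walk : ∀ {v ls xs} → Chain v ls → WalkFromTo E v r xs → ls ⊆ xs
  chain⊆walk at-root here = ⊆-refl
  chain⊆walk at-root (step _ _) = refl ∷ []⊆-universal _
  chain⊆walk (up (v≢r , _) _) here = contradiction refl v≢r
  chain⊆walk (up (_ , u≢v , u⊒v , _) ch) (step e w) with ∈-all-paths⇒∈-walk u⊒v (step e w)
  ... | here u≡v = contradiction u≡v u≢v
  ... | there u∈w with ∈-∃++ u∈w
  ...   | as , bs , refl = refl ∷ ++⁺ˡ as (chain⊆walk ch (proj₂ (walk-split as w)))

  postdom∈chain : ∀ {v ls y} → Chain v ls → PostDom E r y v → y ∈ₗ ls
  postdom∈chain at-root y⊒r = y⊒r (r ∷ []) (here , [] ∷ [])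
  postdom∈chain {v} {y = y} (up (_ , _ , _ , u-greatest) ch) y⊒v with y ≟ v
  ... | yes y≡v = here y≡v
  ... | no y≢v = there (postdom∈chain ch (u-greatest y y≢v y⊒v))

  ⊆-all-paths⇒⊆-chain : ∀ {v ls q₀ ys} → Chain v ls → PathFromTo E v r q₀ →
                        (∀ q → PathFromTo E v r q → ys ⊆ q) → ys ⊆ ls
  ⊆-all-paths⇒⊆-chain ch (w₀ , q₀!) ys⊆paths =
    unique-⊆-by-∈ q₀! (chain⊆walk ch w₀) (ys⊆paths _ (w₀ , q₀!))
      λ y∈ys → postdom∈chain ch λ q qp → lookup (ys⊆paths q qp) y∈ys

module _ {n : ℕ} (G : STGraph n) where

  open STGraph G
  open import Data.List.Relation.Binary.Sublist.DecPropositional (_≟_ {n}) using (_⊆?_)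

  private
    module SChains = PostDominatorChains G (flip E?) s
    module TChains = PostDominatorChains G E? t

  sdom⇔postdomʳ : ∀ {u v} → SDom G u v ⇔ PostDom (flip E) s u v
  sdom⇔postdomʳ = mk⇔ (λ dom q qp → reverse⁻ (dom _ (path-reverse qp)))
                      (λ dom p pp → reverse⁻ (dom _ (path-reverse pp)))

  sdom-chain : ∀ v → ∃ (UpChain G (SDom G) s v)
  sdom-chain v = Product.map₂ (UpChain-resp-⇔ G (⇔-sym sdom⇔postdomʳ))
                   (SChains.chain-from-walk (walk-reverse (proj₁ (proj₂ (reach-from-s v)))))

  tdom-chain : ∀ v → ∃ (UpChain G (TDom G) t v)
  tdom-chain v = TChains.chain-from-walk (proj₁ (proj₂ (reach-to-t v)))

  ext-exists : ∀ v → ∃ (ExtIs G v)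
  ext-exists v with sdom-chain v | tdom-chain v
  ... | ls , chs | lt , cht = _ , ls , lt , chs , cht , refl

  sdom-chain⊆walk : ∀ {v ls xs} → UpChain G (SDom G) s v ls → WalkFromTo E s v xs →
                    reverse ls ⊆ xs
  sdom-chain⊆walk ch w =
    ⊆-reverseʳ (SChains.chain⊆walk (UpChain-resp-⇔ G sdom⇔postdomʳ ch) (walk-reverse w))

  ext⊆walk : ∀ {v L W} → ExtIs G v L → STWalk G W → v ∈ₗ W → L ⊆ W
  ext⊆walk {v} (ls , lt , chs , cht , refl) w v∈W with ∈-∃++ v∈W
  ... | as , bs , refl with walk-split as w
  ...   | w₁ , w₂ = subst (_ ⊆_) (++-assoc as (v ∷ []) bs)
                      (++⁺ (sdom-chain⊆walk chs w₁) (drop⁺-⊆ 1 (TChains.chain⊆walk cht w₂)))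

  ⊆-all-s-paths⇒⊆-ext-prefix : ∀ {v ls ys} → UpChain G (SDom G) s v ls →
                               (∀ p → PathFromTo E s v p → ys ⊆ p) → ys ⊆ reverse ls
  ⊆-all-s-paths⇒⊆-ext-prefix {v} ch ys⊆paths =
    ⊆-reverseˡ (SChains.⊆-all-paths⇒⊆-chain (UpChain-resp-⇔ G sdom⇔postdomʳ ch)
      (path-reverse (proj₂ (reach-from-s v)))
      λ q qp → ⊆-reverseʳ (ys⊆paths _ (path-reverse qp)))

  ⊆-all-t-paths⇒⊆-ext-suffix : ∀ {v lt zs} → UpChain G (TDom G) t v lt →
                               (∀ q → PathFromTo E v t q → zs ⊆ drop 1 q) → zs ⊆ drop 1 lt
  ⊆-all-t-paths⇒⊆-ext-suffix {v} ch zs⊆paths =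
    drop⁺-⊆ 1 (TChains.⊆-all-paths⇒⊆-chain ch (proj₂ (reach-to-t v))
      λ q qp → subst (_ ⊆_) (sym (walk-head (proj₁ qp))) (refl ∷ zs⊆paths q qp))

  ext-or-avoiding-walk : ∀ {v L} → ExtIs G v L → ∀ X →
                         X ⊆ L ⊎ ∃ λ W → STWalk G W × v ∈ₗ W × ¬ X ⊆ W
  ext-or-avoiding-walk {v} (ls , lt , chs , cht , refl) X
    with splits-or-cuts (λ ys → all-paths-or-counterexample E? (ys ⊆?_) s v)
                        (λ zs → all-paths-or-counterexample E? (λ q → zs ⊆? drop 1 q) v t)
                        (λ _ _ → []⊆-universal _) [] X (λ _ _ → []⊆-universal _)
  ... | inj₁ (ys , zs , refl , ys-forced , zs-forced) =
    inj₁ (++⁺ (⊆-all-s-paths⇒⊆-ext-prefix chs ys-forced)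
              (⊆-all-t-paths⇒⊆-ext-suffix cht zs-forced))
  ... | inj₂ (ys , x , zs , refl , (p , (wp , _) , ys∷x⊈p) , (q , (wq , _) , x∷zs⊈q)) =
    inj₂ (p ++ drop 1 q , walk-++ wp wq , ∈-++⁺ˡ (walk-end∈ wp) ,
          [ ys∷x⊈p , x∷zs⊈q ]′ ∘ ++∷⊆++⁻ ys p)

theorem3p7 : {n : ℕ} (G : STGraph n) (C : Subset n) (X : List (Fin n)) →
    Linked G X →
    Safe G C X ⇔ (∃ λ v → v ∈ C × ∃ λ L → ExtIs G v L × X ⊆ L)
theorem3p7 {n} G C X _ = mk⇔ safe⇒ext ext⇒safe
  where
  open import Data.List.Relation.Binary.Sublist.DecPropositional (_≟_ {n}) using (_⊆?_)

  ext⇒safe : (∃ λ v → v ∈ C × ∃ λ L → ExtIs G v L × X ⊆ L) → Safe G C X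
  ext⇒safe (v , v∈C , L , ext , X⊆L) P (P-walks , P-covers) with P-covers v v∈C
  ... | W , W∈P , v∈W = W , W∈P , ⊆-trans X⊆L (ext⊆walk G ext (P-walks W W∈P) v∈W)

  X-avoiding : List (Fin n) → Set
  X-avoiding W = STWalk G W × ¬ X ⊆ W

  X-avoiding-cover : ¬ (∃ λ v → v ∈ C × X ⊆ proj₁ (ext-exists G v)) → WalkCover G C X-avoiding
  X-avoiding-cover none = (λ _ → proj₁) , covers
    where
    covers : ∀ v → v ∈ C → ∃ λ W → X-avoiding W × v ∈ₗ W
    covers v v∈C with ext-or-avoiding-walk G (proj₂ (ext-exists G v)) X
    ... | inj₁ X⊆L = contradiction (v , v∈C , X⊆L) none
    ... | inj₂ (W , w , v∈W , X⊈W) = W , (w , X⊈W) , v∈W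

  safe⇒ext : Safe G C X → (∃ λ v → v ∈ C × ∃ λ L → ExtIs G v L × X ⊆ L)
  safe⇒ext safe with anyFin? (λ v → v ∈? C ×-dec X ⊆? proj₁ (ext-exists G v))
  ... | yes (v , v∈C , X⊆L) = v , v∈C , _ , proj₂ (ext-exists G v) , X⊆L
  ... | no none with safe X-avoiding (X-avoiding-cover none)
  ...   | _ , (_ , X⊈W) , X⊆W = contradiction X⊆W X⊈W
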